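{- For all $n \geq 1$: (1) $\displaystyle A_{2n}(x) = \sum_{\sigma \in DU_{2n}} x^{\mathrm{mmp}^{(0,1,0,0)}(\sigma)} = \sum_{\sigma \in DU_{2n}} x^{\mathrm{mmp}^{(0,0,0,1)}(\sigma)} = \sum_{\sigma \in UD_{2n}} x^{\mathrm{mmp}^{(0,0,1,0)}(\sigma)}$; (2) $\displaystyle C_{2n}(x) = \sum_{\sigma \in UD_{2n}} x^{\mathrm{mmp}^{(0,1,0,0)}(\sigma)} = \sum_{\sigma \in UD_{2n}} x^{\mathrm{mmp}^{(0,0,0,1)}(\sigma)} = \sum_{\sigma \in DU_{2n}} x^{\mathrm{mmp}^{(0,0,1,0)}(\sigma)}$; (3) $\displaystyle B_{2n-1}(x) = \sum_{\sigma \in UD_{2n-1}} x^{\mathrm{mmp}^{(0,1,0,0)}(\sigma)} = \sum_{\sigma \in DU_{2n-1}} x^{\mathrm{mmp}^{(0,0,0,1)}(\sigma)} = \sum_{\sigma \in DU_{2n-1}} x^{\mathrm{mmp}^{(0,0,1,0)}(\sigma)}$; (4) $\displaystyle D_{2n-1}(x) = \sum_{\sigma \in DU_{2n-1}} x^{\mathrm{mmp}^{(0,1,0,0)}(\sigma)} = \sum_{\sigma \in UD_{2n-1}} x^{\mathrm{mmp}^{(0,0,0,1)}(\sigma)} = \sum_{\sigma \in UD_{2n-1}} x^{\mathrm{mmp}^{(0,0,1,0)}(\sigma)}$.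
   Context: For a permutation $\sigma = \sigma_1 \ldots \sigma_n \in S_n$ (one-line notation), define: $\mathrm{mmp}^{(1,0,0,0)}(\sigma)$ = number of $i$ such that there is $j>i$ with $\sigma_j>\sigma_i$; $\mathrm{mmp}^{(0,1,0,0)}(\sigma)$ = number of $i$ such that there is $j<i$ with $\sigma_j>\sigma_i$; $\mathrm{mmp}^{(0,0,1,0)}(\sigma)$ = number of $i$ such that there is $j<i$ with $\sigma_j<\sigma_i$; $\mathrm{mmp}^{(0,0,0,1)}(\sigma)$ = number of $i$ such that there is $j>i$ with $\sigma_j<\sigma_i$. $UD_n$ is the set of up-down permutations $\sigma\in S_n$ ($\sigma_1<\sigma_2>\sigma_3<\sigma_4>\cdots$) and $DU_n$ the set of down-up permutations ($\sigma_1>\sigma_2<\sigma_3>\sigma_4<\cdots$). For $n\ge1$: $A_{2n}(x)=\sum_{\sigma\in UD_{2n}}x^{\mathrm{mmp}^{(1,0,0,0)}(\sigma)}$, $B_{2n-1}(x)=\sum_{\sigma\in UD_{2n-1}}x^{\mathrm{mmp}^{(1,0,0,0)}(\sigma)}$, $C_{2n}(x)=\sum_{\sigma\in DU_{2n}}x^{\mathrm{mmp}^{(1,0,0,0)}(\sigma)}$, $D_{2n-1}(x)=\sum_{\sigma\in DU_{2n-1}}x^{\mathrm{mmp}^{(1,0,0,0)}(\sigma)}$. -}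

module Defs where

open import Data.Bool.Base using (Bool; true; false; _∧_; _∨_; not; if_then_else_)
open import Data.Nat.Base using (ℕ; zero; suc; _<ᵇ_; _≡ᵇ_; _%_)
open import Data.Fin.Base using (Fin; toℕ)
open import Data.Vec.Base using (Vec; []; _∷_; lookup)
open import Data.List.Base using (List; []; _∷_; [_]; map; concatMap; allFin; filterᵇ; length)
open import Data.Bool.ListAction using (all; any)

-- A permutation σ ∈ S_n in one-line notation is a word σ = σ_1 … σ_n
-- (stored 0-indexed as a vector of length n over Fin n) with pairwise
-- distinct entries.

words : (m n : ℕ) → List (Vec (Fin m) n)
words m zero    = [ [] ]
words m (suc n) = concatMap (λ v → map (λ a → a ∷ v) (allFin m)) (words m n)

_<ꟳ_ : ∀ {n} → Fin n → Fin n → Bool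
i <ꟳ j = toℕ i <ᵇ toℕ j

_≡ꟳ_ : ∀ {n} → Fin n → Fin n → Bool
i ≡ꟳ j = toℕ i ≡ᵇ toℕ j

isPerm : ∀ {n} → Vec (Fin n) n → Bool
isPerm {n} σ = all (λ i → all (λ j → (i ≡ꟳ j) ∨ not (lookup σ i ≡ꟳ lookup σ j)) (allFin n)) (allFin n)

Sym : (n : ℕ) → List (Vec (Fin n) n)
Sym n = filterᵇ isPerm (words n n)

-- Up-down: σ_1 < σ_2 > σ_3 < σ_4 > ⋯ .  In 0-indexed positions i, i+1:
-- if i is even we need σ_i < σ_{i+1}, if i is odd we need σ_i > σ_{i+1}.
isUD : ∀ {n} → Vec (Fin n) n → Bool
isUD {n} σ = all (λ i → all (λ j → not (suc (toℕ i) ≡ᵇ toℕ j) ∨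
                   (if toℕ i % 2 ≡ᵇ 0 then lookup σ i <ꟳ lookup σ j
                                       else lookup σ j <ꟳ lookup σ i))
                 (allFin n)) (allFin n)

isDU : ∀ {n} → Vec (Fin n) n → Bool
isDU {n} σ = all (λ i → all (λ j → not (suc (toℕ i) ≡ᵇ toℕ j) ∨
                   (if toℕ i % 2 ≡ᵇ 0 then lookup σ j <ꟳ lookup σ i
                                       else lookup σ i <ꟳ lookup σ j))
                 (allFin n)) (allFin n)

countPos : ∀ {n} → (Fin n → Bool) → ℕ
countPos {n} p = length (filterᵇ p (allFin n))

mmp1000 : ∀ {n} → Vec (Fin n) n → ℕ
mmp1000 {n} σ = countPos (λ i → any (λ j → (i <ꟳ j) ∧ (lookup σ i <ꟳ lookup σ j)) (allFin n))

mmp0100 : ∀ {n} → Vec (Fin n) n → ℕ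
mmp0100 {n} σ = countPos (λ i → any (λ j → (j <ꟳ i) ∧ (lookup σ i <ꟳ lookup σ j)) (allFin n))

mmp0010 : ∀ {n} → Vec (Fin n) n → ℕ
mmp0010 {n} σ = countPos (λ i → any (λ j → (j <ꟳ i) ∧ (lookup σ j <ꟳ lookup σ i)) (allFin n))

mmp0001 : ∀ {n} → Vec (Fin n) n → ℕ
mmp0001 {n} σ = countPos (λ i → any (λ j → (i <ꟳ j) ∧ (lookup σ j <ꟳ lookup σ i)) (allFin n))

-- A polynomial in ℕ[x] is represented by its coefficient sequence ℕ → ℕ;
-- two polynomials are equal iff their coefficient sequences agree pointwise.
-- GF n P st = Σ_{σ ∈ S_n, P σ} x^{st σ}; its k-th coefficient is the number
-- of σ ∈ S_n with P σ and st σ = k.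
GF : (n : ℕ) → (Vec (Fin n) n → Bool) → (Vec (Fin n) n → ℕ) → ℕ → ℕ
GF n P st k = length (filterᵇ (λ σ → P σ ∧ (st σ ≡ᵇ k)) (Sym n))

A : ℕ → ℕ → ℕ   -- A n = A_{n} for even n (used at 2n)
A m = GF m isUD mmp1000
B : ℕ → ℕ → ℕ   -- used at 2n-1
B m = GF m isUD mmp1000
C : ℕ → ℕ → ℕ   -- used at 2n
C m = GF m isDU mmp1000
D : ℕ → ℕ → ℕ   -- used at 2n-1
D m = GF m isDU mmp1000

-- Reversal and complement are involutions of S_n.  Reversal carries
-- mmp^(0,1,0,0) to mmp^(1,0,0,0) and mmp^(0,0,1,0) to mmp^(0,0,0,1), complement
-- carries mmp^(0,0,0,1) to mmp^(1,0,0,0).  Complement exchanges up-down and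
-- down-up permutations, while reversal exchanges them for even n and preserves
-- each class for odd n.  Every identity is therefore induced by reversal, by
-- complement, or by their composite.

module Submission where

open import Defs
open import Algebra.Definitions using (Involutive)
open import Data.Bool.Base using (Bool; true; false; not; _∧_; _∨_; _xor_; if_then_else_; T)
open import Data.Bool.ListAction using (and; or; all; any)
open import Data.Bool.Properties using (T-≡; ⇔→≡; not-involutive; not-distribˡ-xor; xor-same)
open import Data.Fin.Base using (Fin; toℕ; opposite)
open import Data.Fin.Properties using (toℕ-injective; toℕ<n; opposite-prop; opposite-involutive)
open import Data.List.Base
  using ([]; _∷_; _++_; map; concatMap; filterᵇ; length; allFin; cartesianProductWith)
open import Data.List.Properties using (map-cong; filter-≐)
open import Data.List.Membership.Propositional using (_∈_)
open import Data.List.Membership.Propositional.Properties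
  using (∈-map⁺; ∈-map⁻; ∈-allFin; ∈-filter⁺; ∈-filter⁻; ∈-cartesianProductWith⁺)
open import Data.List.Membership.Propositional.Properties.WithK using (unique∧set⇒bag)
open import Data.List.Relation.Binary.BagAndSetEquality using (∼bag⇒↭)
open import Data.List.Relation.Binary.Permutation.Propositional using (_↭_)
open import Data.List.Relation.Binary.Permutation.Propositional.Properties using (↭-length; filter-↭)
open import Data.List.Relation.Unary.All using ([])
open import Data.List.Relation.Unary.AllPairs using ([]; _∷_)
open import Data.List.Relation.Unary.Any using (here; satisfied)
open import Data.List.Relation.Unary.Unique.Propositional using (Unique)
import Data.List.Relation.Unary.All.Properties as All
import Data.List.Relation.Unary.Any.Properties as Any
import Data.List.Relation.Unary.Unique.Propositional.Properties as Unique
open import Data.Nat.Base using (ℕ; zero; suc; _+_; _*_; _∸_; _≤_; _<_; _≡ᵇ_; _%_; s≤s)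
open import Data.Nat.Properties
  using (≡ᵇ⇒≡; ≡⇒≡ᵇ; <ᵇ⇒<; <⇒<ᵇ; ∸-monoʳ-<; m∸n+n≡m; +-cancelʳ-≡; +-suc; +-identityʳ)
open import Data.Product.Base using (_×_; _,_; ∃; proj₂; swap)
open import Data.Vec.Base using (Vec; []; _∷_; lookup; tabulate) renaming (map to mapᵥ)
open import Data.Vec.Properties
  using (lookup∘tabulate; tabulate∘lookup; tabulate-cong; lookup-map; map-∘; map-id; ∷-injective)
  renaming (map-cong to mapᵥ-cong)
open import Function.Base using (_∘_)
open import Function.Bundles using (_⇔_; mk⇔; module Equivalence)
import Function.Properties.Equivalence as ⇔
open import Relation.Binary.PropositionalEquality
  using (_≡_; _≗_; refl; sym; trans; cong; cong₂; subst; subst₂; module ≡-Reasoning)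
open import Relation.Nullary.Decidable.Core using (T?)

open Equivalence using (to; from)
open ≡-Reasoning

T-injective : ∀ {x y} → T x ⇔ T y → x ≡ y
T-injective x⇔y = ⇔→≡ (⇔.trans (⇔.sym T-≡) (⇔.trans x⇔y T-≡))

T-∨-not : ∀ {x y} → T (x ∨ not y) ⇔ (T y → T x)
T-∨-not {true}          = mk⇔ (λ _ _ → _) (λ _ → _)
T-∨-not {false} {true}  = mk⇔ (λ ()) (λ y⇒x → y⇒x _)
T-∨-not {false} {false} = mk⇔ (λ _ ()) (λ _ → _)

if-not : ∀ {A : Set} b {x y : A} → (if not b then x else y) ≡ (if b then y else x)
if-not true  = refl
if-not false = refl

xor-not-xor-cancel : ∀ d x y → (d xor not (x xor y)) xor x ≡ not (d xor y)
xor-not-xor-cancel false false false = refl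
xor-not-xor-cancel false false true  = refl
xor-not-xor-cancel false true  false = refl
xor-not-xor-cancel false true  true  = refl
xor-not-xor-cancel true  false false = refl
xor-not-xor-cancel true  false true  = refl
xor-not-xor-cancel true  true  false = refl
xor-not-xor-cancel true  true  true  = refl

guarded-cong : ∀ {g g′ x y} → g ≡ g′ → (T g′ → x ≡ y) → (not g ∨ x) ≡ (not g′ ∨ y)
guarded-cong {g′ = true}  refl x≡y = x≡y _
guarded-cong {g′ = false} refl _   = refl

involutive⇒injective : ∀ {A : Set} {f : A → A} → Involutive _≡_ f → ∀ {x y} → f x ≡ f y → x ≡ y
involutive⇒injective {f = f} inv {x} {y} fx≡fy = trans (sym (inv x)) (trans (cong f fx≡fy) (inv y))

module _ {A : Set} where

  all-cong : ∀ {p q : A → Bool} → p ≗ q → ∀ xs → all p xs ≡ all q xs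
  all-cong p≗q xs = cong and (map-cong p≗q xs)

  any-cong : ∀ {p q : A → Bool} → p ≗ q → ∀ xs → any p xs ≡ any q xs
  any-cong p≗q xs = cong or (map-cong p≗q xs)

  length-filterᵇ-cong : ∀ {p q : A → Bool} → p ≗ q → ∀ xs →
                        length (filterᵇ p xs) ≡ length (filterᵇ q xs)
  length-filterᵇ-cong {p} {q} p≗q xs =
    cong length (filter-≐ (T? ∘ p) (T? ∘ q)
                          ((λ {x} → subst T (p≗q x)) , (λ {x} → subst T (sym (p≗q x)))) xs)

  length-filterᵇ-map : ∀ (p : A → Bool) (f : A → A) xs →
                       length (filterᵇ p (map f xs)) ≡ length (filterᵇ (p ∘ f) xs)
  length-filterᵇ-map p f []       = refl
  length-filterᵇ-map p f (x ∷ xs) with p (f x)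
  ... | true  = cong suc (length-filterᵇ-map p f xs)
  ... | false = length-filterᵇ-map p f xs

  map-involution-↭ : ∀ {f : A → A} {xs} → Involutive _≡_ f → Unique xs →
                     (∀ {x} → x ∈ xs → f x ∈ xs) → map f xs ↭ xs
  map-involution-↭ {f} {xs} inv uniq closed =
    ∼bag⇒↭ (unique∧set⇒bag (Unique.map⁺ (involutive⇒injective inv) uniq) uniq (mk⇔ into onto))
    where
    into : ∀ {x} → x ∈ map f xs → x ∈ xs
    into x∈ with _ , y∈ , refl ← ∈-map⁻ f x∈ = closed y∈
    onto : ∀ {x} → x ∈ xs → x ∈ map f xs
    onto {x} x∈ = subst (_∈ map f xs) (inv x) (∈-map⁺ f (closed x∈))

  length-filterᵇ-involution : ∀ {f : A → A} {xs} → Involutive _≡_ f → Unique xs →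
                              (∀ {x} → x ∈ xs → f x ∈ xs) → ∀ p →
                              length (filterᵇ p xs) ≡ length (filterᵇ (p ∘ f) xs)
  length-filterᵇ-involution {f} {xs} inv uniq closed p = begin
    length (filterᵇ p xs)         ≡⟨ ↭-length (filter-↭ (T? ∘ p) (map-involution-↭ inv uniq closed)) ⟨
    length (filterᵇ p (map f xs)) ≡⟨ length-filterᵇ-map p f xs ⟩
    length (filterᵇ (p ∘ f) xs)   ∎

module _ {n : ℕ} where

  all² : (Fin n → Fin n → Bool) → Bool
  all² h = all (λ i → all (h i) (allFin n)) (allFin n)

  T-all : (p : Fin n → Bool) → T (all p (allFin n)) ⇔ (∀ i → T (p i))
  T-all p = mk⇔ (All.tabulate⁻ ∘ All.all⁺ p (allFin n)) (All.all⁻ p ∘ All.tabulate⁺)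

  T-any : (p : Fin n → Bool) → T (any p (allFin n)) ⇔ ∃ (T ∘ p)
  T-any p = mk⇔ (satisfied ∘ Any.any⁻ p (allFin n))
                (λ (i , pᵢ) → Any.any⁺ p (Any.tabulate⁺ {f = λ i → i} i pᵢ))

  T-all² : (h : Fin n → Fin n → Bool) → T (all² h) ⇔ (∀ i j → T (h i j))
  T-all² h = mk⇔ (λ t i → to (T-all (h i)) (to (T-all _) t i))
                 (λ t → from (T-all _) (λ i → from (T-all (h i)) (t i)))

  all²-cong : ∀ {h h′ : Fin n → Fin n → Bool} → (∀ i j → h i j ≡ h′ i j) → all² h ≡ all² h′
  all²-cong h≗h′ = all-cong (λ i → all-cong (h≗h′ i) (allFin n)) (allFin n)

  any-opposite : (p : Fin n → Bool) → any p (allFin n) ≡ any (p ∘ opposite) (allFin n)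
  any-opposite p = T-injective (⇔.trans (T-any p) (⇔.trans reindex (⇔.sym (T-any (p ∘ opposite)))))
    where
    reindex : ∃ (T ∘ p) ⇔ ∃ (T ∘ p ∘ opposite)
    reindex = mk⇔ (λ (i , pᵢ) → opposite i , subst (T ∘ p) (sym (opposite-involutive i)) pᵢ)
                  (λ (i , pᵢ) → opposite i , pᵢ)

  all²-opposite-transpose : (h : Fin n → Fin n → Bool) →
                            all² h ≡ all² (λ i j → h (opposite j) (opposite i))
  all²-opposite-transpose h = T-injective (⇔.trans (T-all² h) (⇔.trans reindex (⇔.sym (T-all² _))))
    where
    reindex : (∀ i j → T (h i j)) ⇔ (∀ i j → T (h (opposite j) (opposite i)))
    reindex = mk⇔ (λ t i j → t (opposite j) (opposite i))
                  (λ t i j → subst₂ (λ a b → T (h a b)) (opposite-involutive i) (opposite-involutive j)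
                                    (t (opposite j) (opposite i)))

  countPos-cong : ∀ {p q : Fin n → Bool} → p ≗ q → countPos p ≡ countPos q
  countPos-cong p≗q = length-filterᵇ-cong p≗q (allFin n)

  countPos-opposite : (p : Fin n → Bool) → countPos p ≡ countPos (p ∘ opposite)
  countPos-opposite =
    length-filterᵇ-involution opposite-involutive (Unique.allFin⁺ n) (λ {i} _ → ∈-allFin (opposite i))

  countPos-any-opposite : (h : Fin n → Fin n → Bool) →
    countPos (λ i → any (h i) (allFin n)) ≡
    countPos (λ i → any (λ j → h (opposite i) (opposite j)) (allFin n))
  countPos-any-opposite h =
    trans (countPos-opposite _) (countPos-cong (λ i → any-opposite (h (opposite i))))

T-≡ꟳ : ∀ {n} {i j : Fin n} → T (i ≡ꟳ j) ⇔ i ≡ j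
T-≡ꟳ = mk⇔ (toℕ-injective ∘ ≡ᵇ⇒≡ _ _) (≡⇒≡ᵇ _ _ ∘ cong toℕ)

opposite-<ꟳ : ∀ {n} (i j : Fin n) → (opposite i <ꟳ opposite j) ≡ (j <ꟳ i)
opposite-<ꟳ {n} i j = T-injective (mk⇔ reflect (preserve i j))
  where
  preserve : ∀ (i j : Fin n) → T (j <ꟳ i) → T (opposite i <ꟳ opposite j)
  preserve i j j<i = <⇒<ᵇ (subst₂ _<_ (sym (opposite-prop i)) (sym (opposite-prop j))
                                         (∸-monoʳ-< (s≤s (<ᵇ⇒< _ _ j<i)) (toℕ<n i)))
  reflect : T (opposite i <ꟳ opposite j) → T (j <ꟳ i)
  reflect h = subst₂ (λ a b → T (a <ꟳ b)) (opposite-involutive j) (opposite-involutive i)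
                      (preserve (opposite j) (opposite i) h)

toℕ-opposite-+ : ∀ {n} (i : Fin n) → toℕ (opposite i) + suc (toℕ i) ≡ n
toℕ-opposite-+ i = trans (cong (_+ suc (toℕ i)) (opposite-prop i)) (m∸n+n≡m (toℕ<n i))

opposite-adjacent : ∀ {n} (i j : Fin n) →
                    suc (toℕ i) ≡ toℕ j → suc (toℕ (opposite j)) ≡ toℕ (opposite i)
opposite-adjacent {n} i j i+1≡j = +-cancelʳ-≡ (suc (toℕ i)) _ _ (begin
  suc (toℕ (opposite j) + suc (toℕ i)) ≡⟨ +-suc (toℕ (opposite j)) (suc (toℕ i)) ⟨
  toℕ (opposite j) + suc (suc (toℕ i)) ≡⟨ cong (λ k → toℕ (opposite j) + suc k) i+1≡j ⟩
  toℕ (opposite j) + suc (toℕ j)       ≡⟨ toℕ-opposite-+ j ⟩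
  n                                    ≡⟨ toℕ-opposite-+ i ⟨
  toℕ (opposite i) + suc (toℕ i)       ∎)

adjacent-opposite : ∀ {n} (i j : Fin n) →
  (suc (toℕ (opposite j)) ≡ᵇ toℕ (opposite i)) ≡ (suc (toℕ i) ≡ᵇ toℕ j)
adjacent-opposite i j = T-injective (mk⇔ (≡⇒≡ᵇ _ _ ∘ reflect ∘ ≡ᵇ⇒≡ _ _)
                                         (≡⇒≡ᵇ _ _ ∘ opposite-adjacent i j ∘ ≡ᵇ⇒≡ _ _))
  where
  reflect : suc (toℕ (opposite j)) ≡ toℕ (opposite i) → suc (toℕ i) ≡ toℕ j
  reflect adj = subst₂ (λ a b → suc (toℕ a) ≡ toℕ b) (opposite-involutive i) (opposite-involutive j)
                       (opposite-adjacent (opposite j) (opposite i) adj)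

even : ℕ → Bool
even k = k % 2 ≡ᵇ 0

even-suc : ∀ k → even (suc k) ≡ not (even k)
even-suc zero          = refl
even-suc (suc zero)    = refl
even-suc (suc (suc k)) = even-suc k

even-+ : ∀ m n → even (m + n) ≡ not (even m xor even n)
even-+ zero          n = sym (not-involutive (even n))
even-+ (suc zero)    n = even-suc n
even-+ (suc (suc m)) n = even-+ m n

even-2* : ∀ k → even (2 * k) ≡ true
even-2* k = begin
  even (k + (k + 0))             ≡⟨ even-+ k (k + 0) ⟩
  not (even k xor even (k + 0))  ≡⟨ cong (λ l → not (even k xor even l)) (+-identityʳ k) ⟩
  not (even k xor even k)        ≡⟨ cong not (xor-same (even k)) ⟩
  true                           ∎

even-2*suc-∸1 : ∀ k → even (2 * suc k ∸ 1) ≡ false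
even-2*suc-∸1 k = trans (cong even (+-suc k (k + 0))) (trans (even-suc (2 * k)) (cong not (even-2* k)))

even-adjacent-opposite : ∀ {n} (i j : Fin n) → suc (toℕ i) ≡ toℕ j →
                         even n ≡ not (even (toℕ (opposite j)) xor even (toℕ i))
even-adjacent-opposite {n} i j i+1≡j = begin
  even n                                           ≡⟨ cong even (toℕ-opposite-+ j) ⟨
  even (toℕ (opposite j) + suc (toℕ j))            ≡⟨ cong (λ k → even (toℕ (opposite j) + suc k)) i+1≡j ⟨
  even (toℕ (opposite j) + suc (suc (toℕ i)))      ≡⟨ even-+ (toℕ (opposite j)) (suc (suc (toℕ i))) ⟩
  not (even (toℕ (opposite j)) xor even (toℕ i))   ∎

concatMap-map≡cartesianProductWith : ∀ {A B C : Set} (f : A → B → C) xs ys →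
  concatMap (λ x → map (f x) ys) xs ≡ cartesianProductWith f xs ys
concatMap-map≡cartesianProductWith f []       ys = refl
concatMap-map≡cartesianProductWith f (x ∷ xs) ys =
  cong (map (f x) ys ++_) (concatMap-map≡cartesianProductWith f xs ys)

module _ (m : ℕ) where

  words-suc : ∀ n → words m (suc n) ≡ cartesianProductWith (λ v a → a ∷ v) (words m n) (allFin m)
  words-suc n = concatMap-map≡cartesianProductWith (λ v a → a ∷ v) (words m n) (allFin m)

  ∈-words : ∀ n (v : Vec (Fin m) n) → v ∈ words m n
  ∈-words zero    []      = here refl
  ∈-words (suc n) (a ∷ v) = subst ((a ∷ v) ∈_) (sym (words-suc n))
    (∈-cartesianProductWith⁺ (λ v a → a ∷ v) (∈-words n v) (∈-allFin a))

  words-unique : ∀ n → Unique (words m n)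
  words-unique zero    = [] ∷ []
  words-unique (suc n) = subst Unique (sym (words-suc n))
    (Unique.cartesianProductWith⁺ _ (swap ∘ ∷-injective) (words-unique n) (Unique.allFin⁺ m))

module _ {n : ℕ} where

  Sym-unique : Unique (Sym n)
  Sym-unique = Unique.filter⁺ (T? ∘ isPerm) (words-unique n n)

  ∈-Sym⁺ : ∀ {σ} → T (isPerm σ) → σ ∈ Sym n
  ∈-Sym⁺ {σ} = ∈-filter⁺ (T? ∘ isPerm) (∈-words n n σ)

  ∈-Sym⁻ : ∀ {σ} → σ ∈ Sym n → T (isPerm σ)
  ∈-Sym⁻ = proj₂ ∘ ∈-filter⁻ (T? ∘ isPerm) {xs = words n n}

  T-isPerm : (σ : Vec (Fin n) n) → T (isPerm σ) ⇔ (∀ i j → lookup σ i ≡ lookup σ j → i ≡ j)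
  T-isPerm σ = ⇔.trans (T-all² _) (mk⇔
    (λ t i j → to T-≡ꟳ ∘ to T-∨-not (t i j) ∘ from T-≡ꟳ)
    (λ inj i j → from T-∨-not (from T-≡ꟳ ∘ inj i j ∘ to T-≡ꟳ)))

  GF-cong : ∀ {P P′ : Vec (Fin n) n → Bool} {st st′ : Vec (Fin n) n → ℕ} →
            P ≗ P′ → st ≗ st′ → GF n P st ≗ GF n P′ st′
  GF-cong P≗P′ st≗st′ k =
    length-filterᵇ-cong (λ σ → cong₂ (λ b s → b ∧ (s ≡ᵇ k)) (P≗P′ σ) (st≗st′ σ)) (Sym n)

  GF-symmetry : ∀ {f : Vec (Fin n) n → Vec (Fin n) n} → Involutive _≡_ f →
                (∀ σ → T (isPerm σ) → T (isPerm (f σ))) →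
                ∀ {P Q st st′} → P ∘ f ≗ Q → st ∘ f ≗ st′ → GF n P st ≗ GF n Q st′
  GF-symmetry inv perm {P} {st = st} P∘f≗Q st∘f≗st′ k =
    trans (length-filterᵇ-involution inv Sym-unique (λ {σ} → ∈-Sym⁺ ∘ perm σ ∘ ∈-Sym⁻)
                                     (λ σ → P σ ∧ (st σ ≡ᵇ k)))
          (GF-cong P∘f≗Q st∘f≗st′ k)

reverse : ∀ {A : Set} {n} → Vec A n → Vec A n
reverse σ = tabulate (lookup σ ∘ opposite)

complement : ∀ {m n} → Vec (Fin m) n → Vec (Fin m) n
complement = mapᵥ opposite

module _ {A : Set} {n : ℕ} where

  lookup-reverse : (σ : Vec A n) (i : Fin n) → lookup (reverse σ) i ≡ lookup σ (opposite i)
  lookup-reverse σ = lookup∘tabulate (lookup σ ∘ opposite)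

  lookup-reverse-opposite : (σ : Vec A n) (i : Fin n) → lookup (reverse σ) (opposite i) ≡ lookup σ i
  lookup-reverse-opposite σ i =
    trans (lookup-reverse σ (opposite i)) (cong (lookup σ) (opposite-involutive i))

  reverse-involutive : Involutive _≡_ (reverse {A} {n})
  reverse-involutive σ = trans (tabulate-cong (lookup-reverse-opposite σ)) (tabulate∘lookup σ)

module _ {m n : ℕ} where

  lookup-complement : (σ : Vec (Fin m) n) (i : Fin n) → lookup (complement σ) i ≡ opposite (lookup σ i)
  lookup-complement σ i = lookup-map i opposite σ

  complement-involutive : Involutive _≡_ (complement {m} {n})
  complement-involutive σ =
    trans (sym (map-∘ opposite opposite σ)) (trans (mapᵥ-cong opposite-involutive σ) (map-id σ))

module _ {n : ℕ} where

  isPerm-reverse : ∀ (σ : Vec (Fin n) n) → T (isPerm σ) → T (isPerm (reverse σ))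
  isPerm-reverse σ perm = from (T-isPerm (reverse σ)) λ i j σᵣi≡σᵣj →
    involutive⇒injective opposite-involutive (to (T-isPerm σ) perm (opposite i) (opposite j)
      (trans (sym (lookup-reverse σ i)) (trans σᵣi≡σᵣj (lookup-reverse σ j))))

  isPerm-complement : ∀ (σ : Vec (Fin n) n) → T (isPerm σ) → T (isPerm (complement σ))
  isPerm-complement σ perm = from (T-isPerm (complement σ)) λ i j σ̄i≡σ̄j →
    to (T-isPerm σ) perm i j (involutive⇒injective {f = opposite} opposite-involutive
      (trans (sym (lookup-complement σ i)) (trans σ̄i≡σ̄j (lookup-complement σ j))))

  mmp0001-complement : (σ : Vec (Fin n) n) → mmp0001 (complement σ) ≡ mmp1000 σ
  mmp0001-complement σ = countPos-cong λ i → any-cong (λ j → cong ((i <ꟳ j) ∧_)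
    (trans (cong₂ _<ꟳ_ (lookup-complement σ j) (lookup-complement σ i))
           (opposite-<ꟳ (lookup σ j) (lookup σ i)))) (allFin n)

  mmp0100-reverse : (σ : Vec (Fin n) n) → mmp0100 (reverse σ) ≡ mmp1000 σ
  mmp0100-reverse σ = trans (countPos-any-opposite {n} _) (countPos-cong λ i → any-cong (λ j →
    cong₂ _∧_ (opposite-<ꟳ j i)
              (cong₂ _<ꟳ_ (lookup-reverse-opposite σ i) (lookup-reverse-opposite σ j))) (allFin n))

  mmp0010-reverse : (σ : Vec (Fin n) n) → mmp0010 (reverse σ) ≡ mmp0001 σ
  mmp0010-reverse σ = trans (countPos-any-opposite {n} _) (countPos-cong λ i → any-cong (λ j →
    cong₂ _∧_ (opposite-<ꟳ j i)
              (cong₂ _<ꟳ_ (lookup-reverse-opposite σ j) (lookup-reverse-opposite σ i))) (allFin n))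

  zigzag : Bool → Vec (Fin n) n → Bool
  zigzag false = isUD
  zigzag true  = isDU

  zigzag-step : Bool → Vec (Fin n) n → Fin n → Fin n → Bool
  zigzag-step d σ i j = not (suc (toℕ i) ≡ᵇ toℕ j) ∨
    (if d xor even (toℕ i) then lookup σ i <ꟳ lookup σ j else lookup σ j <ꟳ lookup σ i)

  zigzag-all² : ∀ d σ → zigzag d σ ≡ all² (zigzag-step d σ)
  zigzag-all² false σ = refl
  zigzag-all² true  σ = all²-cong {n} λ i j →
    cong (not (suc (toℕ i) ≡ᵇ toℕ j) ∨_) (sym (if-not (even (toℕ i))))

  zigzag-step-complement : ∀ d σ i j → zigzag-step (not d) (complement σ) i j ≡ zigzag-step d σ i j
  zigzag-step-complement d σ i j = cong (not (suc (toℕ i) ≡ᵇ toℕ j) ∨_) (begin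
    (if not d xor e then σ̄ i <ꟳ σ̄ j else σ̄ j <ꟳ σ̄ i)
      ≡⟨ cong₂ (if not d xor e then_else_) (σ̄-< i j) (σ̄-< j i) ⟩
    (if not d xor e then σ′ j <ꟳ σ′ i else σ′ i <ꟳ σ′ j)
      ≡⟨ cong (if_then _ else _) (not-distribˡ-xor d e) ⟨
    (if not (d xor e) then σ′ j <ꟳ σ′ i else σ′ i <ꟳ σ′ j)
      ≡⟨ if-not (d xor e) ⟩
    (if d xor e then σ′ i <ꟳ σ′ j else σ′ j <ꟳ σ′ i)
      ∎)
    where
    e = even (toℕ i)
    σ′ = lookup σ
    σ̄ = lookup (complement σ)
    σ̄-< : ∀ a b → (σ̄ a <ꟳ σ̄ b) ≡ (σ′ b <ꟳ σ′ a)
    σ̄-< a b = trans (cong₂ _<ꟳ_ (lookup-complement σ a) (lookup-complement σ b))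
                    (opposite-<ꟳ (σ′ a) (σ′ b))

  -- Reversal sends the adjacent pair (i, i+1) to (n-2-i, n-1-i), whose first
  -- position has the parity of n + i.
  zigzag-step-reverse : ∀ d σ i j →
    zigzag-step (d xor even n) (reverse σ) (opposite j) (opposite i) ≡ zigzag-step d σ i j
  zigzag-step-reverse d σ i j = guarded-cong (adjacent-opposite i j) λ adj → begin
    (if (d xor even n) xor e′ then σᵣ (opposite j) <ꟳ σᵣ (opposite i)
                              else σᵣ (opposite i) <ꟳ σᵣ (opposite j))
      ≡⟨ cong₂ (if (d xor even n) xor e′ then_else_)
               (cong₂ _<ꟳ_ (lookup-reverse-opposite σ j) (lookup-reverse-opposite σ i))
               (cong₂ _<ꟳ_ (lookup-reverse-opposite σ i) (lookup-reverse-opposite σ j)) ⟩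
    (if (d xor even n) xor e′ then σ′ j <ꟳ σ′ i else σ′ i <ꟳ σ′ j)
      ≡⟨ cong (if_then _ else _)
              (trans (cong (λ b → (d xor b) xor e′) (n-parity adj)) (xor-not-xor-cancel d e′ e)) ⟩
    (if not (d xor e) then σ′ j <ꟳ σ′ i else σ′ i <ꟳ σ′ j)
      ≡⟨ if-not (d xor e) ⟩
    (if d xor e then σ′ i <ꟳ σ′ j else σ′ j <ꟳ σ′ i)
      ∎
    where
    e = even (toℕ i)
    e′ = even (toℕ (opposite j))
    σ′ = lookup σ
    σᵣ = lookup (reverse σ)
    n-parity : T (suc (toℕ i) ≡ᵇ toℕ j) → even n ≡ not (e′ xor e)
    n-parity adj = even-adjacent-opposite i j (≡ᵇ⇒≡ _ _ adj)

  zigzag-complement : ∀ d σ → zigzag (not d) (complement σ) ≡ zigzag d σ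
  zigzag-complement d σ = begin
    zigzag (not d) (complement σ)          ≡⟨ zigzag-all² (not d) (complement σ) ⟩
    all² (zigzag-step (not d) (complement σ)) ≡⟨ all²-cong (zigzag-step-complement d σ) ⟩
    all² (zigzag-step d σ)                 ≡⟨ zigzag-all² d σ ⟨
    zigzag d σ                             ∎

  zigzag-reverse : ∀ d σ → zigzag (d xor even n) (reverse σ) ≡ zigzag d σ
  zigzag-reverse d σ = begin
    zigzag (d xor even n) (reverse σ)
      ≡⟨ zigzag-all² (d xor even n) (reverse σ) ⟩
    all² (zigzag-step (d xor even n) (reverse σ))
      ≡⟨ all²-opposite-transpose (zigzag-step (d xor even n) (reverse σ)) ⟩
    all² (λ i j → zigzag-step (d xor even n) (reverse σ) (opposite j) (opposite i))
      ≡⟨ all²-cong (zigzag-step-reverse d σ) ⟩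
    all² (zigzag-step d σ)
      ≡⟨ zigzag-all² d σ ⟨
    zigzag d σ
      ∎

  -- The parity of n is passed as a separate Boolean e so that, for literal d and e,
  -- zigzag (d xor e) and zigzag (not d xor e) compute to isUD or isDU.
  equidistribution : ∀ d e → even n ≡ e →
    (GF n (zigzag d) mmp1000 ≗ GF n (zigzag (d xor e)) mmp0100) ×
    (GF n (zigzag d) mmp1000 ≗ GF n (zigzag (not d)) mmp0001) ×
    (GF n (zigzag d) mmp1000 ≗ GF n (zigzag (not d xor e)) mmp0010)
  equidistribution d _ refl =
    (λ k → sym (by-reverse k)) ,
    (λ k → sym (by-complement k)) ,
    (λ k → sym (trans (by-reverse-complement k) (by-complement k)))
    where
    by-reverse : GF n (zigzag (d xor even n)) mmp0100 ≗ GF n (zigzag d) mmp1000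
    by-reverse = GF-symmetry {f = reverse} reverse-involutive isPerm-reverse
      {P = zigzag (d xor even n)} {st = mmp0100} (zigzag-reverse d) mmp0100-reverse
    by-complement : GF n (zigzag (not d)) mmp0001 ≗ GF n (zigzag d) mmp1000
    by-complement = GF-symmetry {f = complement} complement-involutive isPerm-complement
      {P = zigzag (not d)} {st = mmp0001} (zigzag-complement d) mmp0001-complement
    by-reverse-complement : GF n (zigzag (not d xor even n)) mmp0010 ≗ GF n (zigzag (not d)) mmp0001
    by-reverse-complement = GF-symmetry {f = reverse} reverse-involutive isPerm-reverse
      {P = zigzag (not d xor even n)} {st = mmp0010} (zigzag-reverse (not d)) mmp0010-reverse

proposition1p1 : (n : ℕ) → 1 ≤ n →
    ((A (2 * n) ≗ GF (2 * n) isDU mmp0100) ×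
     (A (2 * n) ≗ GF (2 * n) isDU mmp0001) ×
     (A (2 * n) ≗ GF (2 * n) isUD mmp0010)) ×
    ((C (2 * n) ≗ GF (2 * n) isUD mmp0100) ×
     (C (2 * n) ≗ GF (2 * n) isUD mmp0001) ×
     (C (2 * n) ≗ GF (2 * n) isDU mmp0010)) ×
    ((B (2 * n ∸ 1) ≗ GF (2 * n ∸ 1) isUD mmp0100) ×
     (B (2 * n ∸ 1) ≗ GF (2 * n ∸ 1) isDU mmp0001) ×
     (B (2 * n ∸ 1) ≗ GF (2 * n ∸ 1) isDU mmp0010)) ×
    ((D (2 * n ∸ 1) ≗ GF (2 * n ∸ 1) isDU mmp0100) ×
     (D (2 * n ∸ 1) ≗ GF (2 * n ∸ 1) isUD mmp0001) ×
     (D (2 * n ∸ 1) ≗ GF (2 * n ∸ 1) isUD mmp0010))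
proposition1p1 (suc m) _ =
  equidistribution {2 * suc m} false true (even-2* (suc m)) ,
  equidistribution {2 * suc m} true  true (even-2* (suc m)) ,
  equidistribution {2 * suc m ∸ 1} false false (even-2*suc-∸1 m) ,
  equidistribution {2 * suc m ∸ 1} true  false (even-2*suc-∸1 m)
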